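{- Let $n\ge 3$, let $s$ and $t$ be any two vertices of the star graph $S_n$, and let $d$ be the distance between $s$ and $t$ in $S_n$. Then the directed distance $\overrightarrow{d}$ from $s$ to $t$ in the oriented star graph $\overrightarrow{S_n}$ satisfies $\overrightarrow{d}\le 4d+4$.
   Context: The $n$-star graph $S_n$ has as vertices the permutations of $[n]$ (viewed as sequences $\pi(1)\cdots\pi(n)$); two permutations are adjacent iff one is obtained from the other by exchanging the values in position $1$ and position $i$ for some $i\in\{2,\dots,n\}$. The sign of a permutation is the parity of its number of inversions. Let $k=\lceil (n-1)/2\rceil+1$. The oriented star graph $\overrightarrow{S_n}$ (Fujita's orientation) has an arc $\pi\to\pi'$ iff $\pi'$ is obtained from $\pi$ by exchanging positions $1$ and $i$, where $i\in\{2,\dots,k\}$ if $\pi$ is even and $i\in\{k+1,\dots,n\}$ if $\pi$ is odd. The directed distance from $s$ to $t$ is the length of a shortest directed path from $s$ to $t$. -}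

module Defs where

open import Data.Nat using (ℕ; zero; suc; _+_; _*_; _∸_; _≤_; _<_; ⌈_/2⌉; _%_)
open import Data.Fin using (Fin; toℕ) renaming (_<_ to _<ᶠ_)
open import Data.Fin.Properties using () renaming (_<?_ to _<ᶠ?_)
open import Data.Vec using (Vec; lookup; _[_]≔_)
open import Data.List using (List; map; allFin)
open import Data.Nat.ListAction using (sum)
open import Data.Bool using (Bool; true; false; if_then_else_; _∧_)
open import Data.Product using (Σ; ∃; _×_; _,_)
open import Data.Sum using (_⊎_)
open import Relation.Nullary using (¬_; does)
open import Relation.Binary.PropositionalEquality using (_≡_)

-- Vertices: sequences π(1)⋯π(n), stored 0-indexed as vectors of values in Fin n.
Seq : ℕ → Set
Seq n = Vec (Fin n) n

-- π is a permutation of [n] (injective, hence bijective, as a map Fin n → Fin n).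
IsPerm : {n : ℕ} → Seq n → Set
IsPerm {n} v = (i j : Fin n) → lookup v i ≡ lookup v j → i ≡ j

swap : {n : ℕ} → Seq n → Fin n → Fin n → Seq n
swap v i j = (v [ i ]≔ lookup v j) [ j ]≔ lookup v i

inversions : {n : ℕ} → Seq n → ℕ
inversions {n} v =
  sum (map (λ i → sum (map (λ j →
         if does (i <ᶠ? j) ∧ does (lookup v j <ᶠ? lookup v i) then 1 else 0)
       (allFin n))) (allFin n))

IsEven : {n : ℕ} → Seq n → Set
IsEven v = inversions v % 2 ≡ 0

-- Star graph S_n: exchange position 1 (index 0) with position i ∈ {2..n} (index ≥ 1).
StarAdj : {n : ℕ} → Seq n → Seq n → Set
StarAdj {n} v w = Σ (Fin n) λ z → Σ (Fin n) λ j →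
  toℕ z ≡ 0 × 1 ≤ toℕ j × w ≡ swap v z j

kOf : ℕ → ℕ
kOf n = ⌈ n ∸ 1 /2⌉ + 1

-- Fujita's orientation: arc π → π' exchanging positions 1 and i (1-based),
-- i ∈ {2..k} if π even, i ∈ {k+1..n} if π odd.  0-based index j = i - 1.
OrientedArc : {n : ℕ} → Seq n → Seq n → Set
OrientedArc {n} v w = Σ (Fin n) λ z → Σ (Fin n) λ j →
  toℕ z ≡ 0 × w ≡ swap v z j ×
  ((IsEven v × 1 ≤ toℕ j × toℕ j + 1 ≤ kOf n)
   ⊎ (¬ IsEven v × kOf n ≤ toℕ j))

data Walk {A : Set} (R : A → A → Set) : A → A → ℕ → Set where
  nil  : ∀ {x} → Walk R x x 0
  cons : ∀ {x y z ℓ} → R x y → Walk R y z ℓ → Walk R x z (suc ℓ)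

IsDistance : {A : Set} → (A → A → Set) → A → A → ℕ → Set
IsDistance R s t d = Walk R s t d × ((m : ℕ) → m < d → ¬ Walk R s t m)

module Submission where

-- Every arc of the star graph exchanges the first entry of a permutation with a
-- later one, and such an exchange always flips the sign.  The orientation lets a
-- permutation use exactly the positions on the "side" of its sign (2..k when even,
-- k+1..n when odd).  Because signs alternate along any walk, alternately using a
-- position x on the current side and a position y on the other side is always a
-- directed walk.  Two identities of transpositions then simulate blocked exchanges:
-- (0 j)(0 i)(0 j)(0 i) realises i-then-j in four arcs, and (0 b)(0 i)(0 b)(0 i)(0 b)
-- realises i alone in five.  Pairing the steps of a star-graph walk of length d
-- gives a directed walk of length at most 4d + 1, and a least-number search over
-- the decidable predicate "there is a directed walk of length ℓ" yields the
-- directed distance.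

open import Defs
open import Data.Nat as ℕ using (ℕ; zero; suc; _+_; _*_; _≤_; _<_; z≤n; s≤s; _%_; parity)
import Data.Nat.Properties as ℕP
open import Data.Fin using (Fin; zero; suc; toℕ; fromℕ)
import Data.Fin.Properties as FinP
open import Data.Fin.Properties using (_≟_) renaming (_<?_ to _<ᶠ?_)
import Data.Fin.Permutation as Perm
open import Data.Fin.Permutation.Components using (transpose)
open import Data.Vec using (Vec; lookup; _[_]≔_)
import Data.Vec.Properties as VecP
open import Data.List using (allFin; map; tabulate)
import Data.List.Properties as ListP
import Data.Nat.ListAction as ListAction
open import Data.Bool using (Bool; true; false; _∧_; if_then_else_)
open import Data.Parity.Base using (Parity; 0ℙ; 1ℙ; _⁻¹) renaming (_+_ to infixl 6 _⊕_; _*_ to infixl 7 _⊗_)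
import Data.Parity.Properties as ℙP
open import Algebra.Properties.CommutativeMonoid.Sum ℙP.+-0-commutativeMonoid
  using (sum-syntax; sum-cong-≗; ∑-distrib-+; ∑-comm; sum-permute)
open import Data.Product using (Σ; _×_; _,_)
open import Data.Sum using (_⊎_; inj₁; inj₂; [_,_]′)
open import Data.Empty using (⊥-elim)
open import Function using (_∘_)
open import Relation.Nullary using (Dec; yes; no; ¬_; does)
open import Relation.Nullary.Decidable using (dec-true; dec-false; toSum; _×-dec_; _⊎-dec_; ¬?)
open import Relation.Binary using (tri<; tri≈; tri>)
open import Relation.Binary.PropositionalEquality

module _ {n : ℕ} where

  transpose-matchˡ : (i j : Fin n) → transpose i j i ≡ j
  transpose-matchˡ i j rewrite dec-true (i ≟ i) refl = refl

  transpose-matchʳ : (i j : Fin n) → transpose i j j ≡ i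
  transpose-matchʳ i j with j ≟ i
  ... | yes j≡i = j≡i
  ... | no _ rewrite dec-true (j ≟ j) refl = refl

  transpose-other : (i j k : Fin n) → k ≢ i → k ≢ j → transpose i j k ≡ k
  transpose-other i j k k≢i k≢j rewrite dec-false (k ≟ i) k≢i | dec-false (k ≟ j) k≢j = refl

  transpose-involutive : (i j k : Fin n) → transpose i j (transpose i j k) ≡ k
  transpose-involutive i j k with toSum (k ≟ i) | toSum (k ≟ j)
  ... | inj₁ refl | _ rewrite transpose-matchˡ k j = transpose-matchʳ k j
  ... | inj₂ _ | inj₁ refl rewrite transpose-matchʳ i k = transpose-matchˡ i k
  ... | inj₂ k≢i | inj₂ k≢j rewrite transpose-other i j k k≢i k≢j = transpose-other i j k k≢i k≢j

  transpose-injective : (i j x y : Fin n) → transpose i j x ≡ transpose i j y → x ≡ y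
  transpose-injective i j x y eq =
    trans (sym (transpose-involutive i j x)) (trans (cong (transpose i j) eq) (transpose-involutive i j y))

  -- (a j)(a i) is a 3-cycle, so its square is its inverse (a i)(a j).
  three-cycle : (a i j : Fin n) → i ≢ a → j ≢ a → i ≢ j → (k : Fin n) →
    transpose a j (transpose a i (transpose a j (transpose a i k))) ≡ transpose a i (transpose a j k)
  three-cycle a i j i≢a j≢a i≢j k with toSum (k ≟ a) | toSum (k ≟ i) | toSum (k ≟ j)
  ... | inj₁ refl | _ | _
    rewrite transpose-matchˡ k i | transpose-other k j i i≢a i≢j | transpose-matchʳ k i
          | transpose-matchˡ k j | transpose-other k i j j≢a (i≢j ∘ sym) = refl
  ... | inj₂ _ | inj₁ refl | _
    rewrite transpose-matchʳ a k | transpose-matchˡ a j | transpose-other a i j j≢a (i≢j ∘ sym)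
          | transpose-matchʳ a j | transpose-other a j k i≢a i≢j | transpose-matchʳ a k = refl
  ... | inj₂ _ | inj₂ _ | inj₁ refl
    rewrite transpose-other a i k j≢a (i≢j ∘ sym) | transpose-matchʳ a k
          | transpose-matchˡ a i | transpose-other a k i i≢a i≢j = refl
  ... | inj₂ k≢a | inj₂ k≢i | inj₂ k≢j
    rewrite transpose-other a i k k≢a k≢i | transpose-other a j k k≢a k≢j
          | transpose-other a i k k≢a k≢i | transpose-other a j k k≢a k≢j = refl

  transpose-conjugate : (a b q : Fin n) → a ≢ b → a ≢ q → b ≢ q → (k : Fin n) →
    transpose a q k ≡ transpose b q (transpose a b (transpose b q k))
  transpose-conjugate a b q a≢b a≢q b≢q k with toSum (k ≟ a) | toSum (k ≟ b) | toSum (k ≟ q)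
  ... | inj₁ refl | _ | _
    rewrite transpose-matchˡ k q | transpose-other b q k a≢b a≢q
          | transpose-matchˡ k b | transpose-matchˡ b q = refl
  ... | inj₂ _ | inj₁ refl | _
    rewrite transpose-other a q k (a≢b ∘ sym) b≢q | transpose-matchˡ k q
          | transpose-other a k q (a≢q ∘ sym) (b≢q ∘ sym) | transpose-matchʳ k q = refl
  ... | inj₂ _ | inj₂ _ | inj₁ refl
    rewrite transpose-matchʳ a k | transpose-matchʳ b k | transpose-matchʳ a b
          | transpose-other b k a a≢b a≢q = refl
  ... | inj₂ k≢a | inj₂ k≢b | inj₂ k≢q
    rewrite transpose-other a q k k≢a k≢q | transpose-other b q k k≢b k≢q
          | transpose-other a b k k≢a k≢b | transpose-other b q k k≢b k≢q = refl

module _ {n : ℕ} where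

  lookup-swap : (v : Seq n) (i j k : Fin n) → lookup (swap v i j) k ≡ lookup v (transpose i j k)
  lookup-swap v i j k with toSum (k ≟ j)
  ... | inj₁ refl = trans (VecP.lookup∘update k (v [ i ]≔ lookup v k) (lookup v i))
                          (cong (lookup v) (sym (transpose-matchʳ i k)))
  ... | inj₂ k≢j rewrite VecP.lookup∘update′ k≢j (v [ i ]≔ lookup v j) (lookup v i) with toSum (k ≟ i)
  ...   | inj₁ refl = trans (VecP.lookup∘update k v _) (cong (lookup v) (sym (transpose-matchˡ k j)))
  ...   | inj₂ k≢i = trans (VecP.lookup∘update′ k≢i v _) (cong (lookup v) (sym (transpose-other i j k k≢i k≢j)))

  vec-ext : {A : Set} (v w : Vec A n) → (∀ k → lookup v k ≡ lookup w k) → v ≡ w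
  vec-ext v w eq = trans (sym (VecP.tabulate∘lookup v))
                         (trans (VecP.tabulate-cong eq) (VecP.tabulate∘lookup w))

  swap-preserves-perm : (v : Seq n) (i j : Fin n) → IsPerm v → IsPerm (swap v i j)
  swap-preserves-perm v i j v-perm x y eq = transpose-injective i j x y
    (v-perm _ _ (trans (sym (lookup-swap v i j x)) (trans eq (lookup-swap v i j y))))

  swap-involutive : (v : Seq n) (i j : Fin n) → swap (swap v i j) i j ≡ v
  swap-involutive v i j = vec-ext _ _ λ k → begin
    lookup (swap (swap v i j) i j) k          ≡⟨ lookup-swap (swap v i j) i j k ⟩
    lookup (swap v i j) (transpose i j k)     ≡⟨ lookup-swap v i j _ ⟩
    lookup v (transpose i j (transpose i j k)) ≡⟨ cong (lookup v) (transpose-involutive i j k) ⟩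
    lookup v k                                ∎
    where open ≡-Reasoning

  swap⁴ : (v : Seq n) (a i j : Fin n) → i ≢ a → j ≢ a → i ≢ j →
    swap (swap (swap (swap v a j) a i) a j) a i ≡ swap (swap v a i) a j
  swap⁴ v a i j i≢a j≢a i≢j = vec-ext _ _ λ k → begin
    lookup (swap w₃ a i) k                 ≡⟨ lookup-swap w₃ a i k ⟩
    lookup w₃ (τ i k)                      ≡⟨ lookup-swap w₂ a j _ ⟩
    lookup w₂ (τ j (τ i k))                ≡⟨ lookup-swap w₁ a i _ ⟩
    lookup w₁ (τ i (τ j (τ i k)))          ≡⟨ lookup-swap v a j _ ⟩
    lookup v (τ j (τ i (τ j (τ i k))))     ≡⟨ cong (lookup v) (three-cycle a i j i≢a j≢a i≢j k) ⟩
    lookup v (τ i (τ j k))                 ≡⟨ lookup-swap v a i _ ⟨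
    lookup (swap v a i) (τ j k)            ≡⟨ lookup-swap (swap v a i) a j k ⟨
    lookup (swap (swap v a i) a j) k       ∎
    where
    open ≡-Reasoning
    τ : Fin n → Fin n → Fin n
    τ = transpose a
    w₁ w₂ w₃ : Seq n
    w₁ = swap v a j
    w₂ = swap w₁ a i
    w₃ = swap w₂ a j

  swap⁵ : (v : Seq n) (a b i : Fin n) → b ≢ a → i ≢ a → b ≢ i →
    swap (swap (swap (swap (swap v a b) a i) a b) a i) a b ≡ swap v a i
  swap⁵ v a b i b≢a i≢a b≢i = begin
    swap (swap (swap (swap (swap v a b) a i) a b) a i) a b ≡⟨ cong (λ w → swap w a b) (swap⁴ v a i b i≢a b≢a (b≢i ∘ sym)) ⟩
    swap (swap (swap v a i) a b) a b                       ≡⟨ swap-involutive (swap v a i) a b ⟩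
    swap v a i                                             ∎
    where open ≡-Reasoning

-- Parity-valued indicators and double sums in the group (Parity, ⊕, 0ℙ);
-- multiplication ⊗ plays the role of conjunction of indicators.

fromBool : Bool → Parity
fromBool true = 1ℙ
fromBool false = 0ℙ

module _ {n : ℕ} where

  ⟦_<_⟧ : Fin n → Fin n → Parity
  ⟦ x < y ⟧ = fromBool (does (x <ᶠ? y))

  ⟦<⟧-irrefl : (x : Fin n) → ⟦ x < x ⟧ ≡ 0ℙ
  ⟦<⟧-irrefl x = cong fromBool (dec-false (x <ᶠ? x) (FinP.<-irrefl refl))

  ⟦<⟧-flip : (x y : Fin n) → x ≢ y → ⟦ y < x ⟧ ≡ ⟦ x < y ⟧ ⁻¹
  ⟦<⟧-flip x y x≢y with FinP.<-cmp x y
  ... | tri< x<y _ _ rewrite dec-true (x <ᶠ? y) x<y | dec-false (y <ᶠ? x) (FinP.<-asym x<y) = refl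
  ... | tri≈ _ x≡y _ = ⊥-elim (x≢y x≡y)
  ... | tri> _ _ y<x rewrite dec-true (y <ᶠ? x) y<x | dec-false (x <ᶠ? y) (FinP.<-asym y<x) = refl

  ⟦<⟧-asym : (x y : Fin n) → ⟦ x < y ⟧ ⊗ ⟦ y < x ⟧ ≡ 0ℙ
  ⟦<⟧-asym x y with toSum (x ≟ y)
  ... | inj₁ refl rewrite ⟦<⟧-irrefl x = refl
  ... | inj₂ x≢y rewrite ⟦<⟧-flip x y x≢y = ℙP.p*p⁻¹≡0ℙ ⟦ x < y ⟧

  ∑∑ : (Fin n → Fin n → Parity) → Parity
  ∑∑ E = ∑[ i < n ] ∑[ j < n ] E i j

  ∑∑-cong : {E F : Fin n → Fin n → Parity} → (∀ i j → E i j ≡ F i j) → ∑∑ E ≡ ∑∑ F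
  ∑∑-cong eq = sum-cong-≗ λ i → sum-cong-≗ (eq i)

  ∑∑-distrib : (E F : Fin n → Fin n → Parity) → ∑∑ (λ i j → E i j ⊕ F i j) ≡ ∑∑ E ⊕ ∑∑ F
  ∑∑-distrib E F = trans (sum-cong-≗ λ i → ∑-distrib-+ (E i) (F i))
                         (∑-distrib-+ (λ i → ∑[ j < n ] E i j) (λ i → ∑[ j < n ] F i j))

  ∑∑-transpose : (a b : Fin n) (E : Fin n → Fin n → Parity) →
    ∑∑ E ≡ ∑∑ (λ i j → E (transpose a b i) (transpose a b j))
  ∑∑-transpose a b E =
    trans (sum-permute (λ i → ∑[ j < n ] E i j) (Perm.transpose a b))
          (sum-cong-≗ λ i → sum-permute (E (transpose a b i)) (Perm.transpose a b))

  ∑-zero : (f : Fin n → Parity) → (∀ i → f i ≡ 0ℙ) → ∑[ i < n ] f i ≡ 0ℙ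
  ∑-zero f f≡0 = trans (sum-cong-≗ f≡0) (zeros n)
    where
    zeros : ∀ m → ∑[ i < m ] 0ℙ ≡ 0ℙ
    zeros zero = refl
    zeros (suc m) = zeros m

  ∑∑-pairs : (E : Fin n → Fin n → Parity) → (∀ i → E i i ≡ 0ℙ) →
    ∑∑ E ≡ ∑∑ (λ i j → ⟦ i < j ⟧ ⊗ (E i j ⊕ E j i))
  ∑∑-pairs E diag = begin
    ∑∑ E
      ≡⟨ ∑∑-cong split ⟩
    ∑∑ (λ i j → ⟦ i < j ⟧ ⊗ E i j ⊕ ⟦ j < i ⟧ ⊗ E i j)
      ≡⟨ ∑∑-distrib (λ i j → ⟦ i < j ⟧ ⊗ E i j) (λ i j → ⟦ j < i ⟧ ⊗ E i j) ⟩
    ∑∑ (λ i j → ⟦ i < j ⟧ ⊗ E i j) ⊕ ∑∑ (λ i j → ⟦ j < i ⟧ ⊗ E i j)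
      ≡⟨ cong (∑∑ (λ i j → ⟦ i < j ⟧ ⊗ E i j) ⊕_) (∑-comm (λ i j → ⟦ j < i ⟧ ⊗ E i j)) ⟩
    ∑∑ (λ i j → ⟦ i < j ⟧ ⊗ E i j) ⊕ ∑∑ (λ i j → ⟦ i < j ⟧ ⊗ E j i)
      ≡⟨ ∑∑-distrib (λ i j → ⟦ i < j ⟧ ⊗ E i j) (λ i j → ⟦ i < j ⟧ ⊗ E j i) ⟨
    ∑∑ (λ i j → ⟦ i < j ⟧ ⊗ E i j ⊕ ⟦ i < j ⟧ ⊗ E j i)
      ≡⟨ ∑∑-cong (λ i j → ℙP.*-distribˡ-+ ⟦ i < j ⟧ (E i j) (E j i)) ⟨
    ∑∑ (λ i j → ⟦ i < j ⟧ ⊗ (E i j ⊕ E j i))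
      ∎
    where
    open ≡-Reasoning
    complement : ∀ p x → x ≡ p ⊗ x ⊕ p ⁻¹ ⊗ x
    complement 0ℙ x = refl
    complement 1ℙ 0ℙ = refl
    complement 1ℙ 1ℙ = refl
    split : ∀ i j → E i j ≡ ⟦ i < j ⟧ ⊗ E i j ⊕ ⟦ j < i ⟧ ⊗ E i j
    split i j with toSum (i ≟ j)
    ... | inj₁ refl rewrite ⟦<⟧-irrefl i | diag i = refl
    ... | inj₂ i≢j rewrite ⟦<⟧-flip i j i≢j = complement ⟦ i < j ⟧ (E i j)

module _ {n : ℕ} where

  invParity : (Fin n → Fin n) → Parity
  invParity f = ∑∑ (λ i j → ⟦ i < j ⟧ ⊗ ⟦ f j < f i ⟧)

  invParity-cong : {f g : Fin n → Fin n} → (∀ k → f k ≡ g k) → invParity f ≡ invParity g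
  invParity-cong eq = ∑∑-cong λ i j → cong₂ (λ x y → ⟦ i < j ⟧ ⊗ ⟦ x < y ⟧) (eq j) (eq i)

  -- For injective f, composing with a transposition adds the inversion parity of
  -- the transposition: inversions of f ∘ τ are counted by comparing, pair by pair,
  -- the relative order of i, j with that of τ i, τ j.
  invParity-∘transpose : (f : Fin n → Fin n) → (∀ x y → f x ≡ f y → x ≡ y) → (a b : Fin n) →
    invParity (f ∘ transpose a b) ≡ invParity f ⊕ invParity (transpose a b)
  invParity-∘transpose f f-inj a b = ⊕-solve (begin
    invParity f ⊕ Q
      ≡⟨ ∑∑-distrib (λ i j → ⟦ i < j ⟧ ⊗ ⟦ f j < f i ⟧) (λ i j → ⟦ τ i < τ j ⟧ ⊗ ⟦ f j < f i ⟧) ⟨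
    ∑∑ (λ i j → ⟦ i < j ⟧ ⊗ ⟦ f j < f i ⟧ ⊕ ⟦ τ i < τ j ⟧ ⊗ ⟦ f j < f i ⟧)
      ≡⟨ ∑∑-cong (λ i j → ℙP.*-distribʳ-+ ⟦ f j < f i ⟧ ⟦ i < j ⟧ ⟦ τ i < τ j ⟧) ⟨
    ∑∑ E
      ≡⟨ ∑∑-pairs E E-diag ⟩
    ∑∑ (λ i j → ⟦ i < j ⟧ ⊗ (E i j ⊕ E j i))
      ≡⟨ ∑∑-cong pair ⟩
    invParity τ
      ∎)
    where
    open ≡-Reasoning
    τ : Fin n → Fin n
    τ = transpose a b
    Q : Parity
    Q = ∑∑ (λ i j → ⟦ τ i < τ j ⟧ ⊗ ⟦ f j < f i ⟧)
    reindex : invParity (f ∘ τ) ≡ Q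
    reindex = trans (∑∑-transpose a b _) (∑∑-cong λ i j →
      cong₂ (λ x y → ⟦ τ i < τ j ⟧ ⊗ ⟦ f x < f y ⟧) (transpose-involutive a b j) (transpose-involutive a b i))
    ⊕-solve : invParity f ⊕ Q ≡ invParity τ → invParity (f ∘ τ) ≡ invParity f ⊕ invParity τ
    ⊕-solve eq = begin
      invParity (f ∘ τ)           ≡⟨ reindex ⟩
      Q                           ≡⟨ cong (_⊕ Q) (ℙP.p+p≡0ℙ (invParity f)) ⟨
      (invParity f ⊕ invParity f) ⊕ Q ≡⟨ ℙP.+-assoc (invParity f) (invParity f) Q ⟩
      invParity f ⊕ (invParity f ⊕ Q) ≡⟨ cong (invParity f ⊕_) eq ⟩
      invParity f ⊕ invParity τ   ∎
    E : Fin n → Fin n → Parity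
    E i j = (⟦ i < j ⟧ ⊕ ⟦ τ i < τ j ⟧) ⊗ ⟦ f j < f i ⟧
    E-diag : ∀ i → E i i ≡ 0ℙ
    E-diag i rewrite ⟦<⟧-irrefl (f i) = ℙP.*-zeroʳ _
    pair-identity : ∀ l t c → l ⊗ ((l ⊕ t) ⊗ c ⊕ (l ⁻¹ ⊕ t ⁻¹) ⊗ c ⁻¹) ≡ l ⊗ t ⁻¹
    pair-identity 0ℙ t c = refl
    pair-identity 1ℙ 0ℙ 0ℙ = refl
    pair-identity 1ℙ 0ℙ 1ℙ = refl
    pair-identity 1ℙ 1ℙ 0ℙ = refl
    pair-identity 1ℙ 1ℙ 1ℙ = refl
    pair : ∀ i j → ⟦ i < j ⟧ ⊗ (E i j ⊕ E j i) ≡ ⟦ i < j ⟧ ⊗ ⟦ τ j < τ i ⟧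
    pair i j with toSum (i ≟ j)
    ... | inj₁ refl rewrite ⟦<⟧-irrefl i = refl
    ... | inj₂ i≢j
      rewrite ⟦<⟧-flip i j i≢j | ⟦<⟧-flip (τ i) (τ j) (i≢j ∘ transpose-injective a b i j)
            | ⟦<⟧-flip (f j) (f i) (i≢j ∘ sym ∘ f-inj j i)
      = pair-identity ⟦ i < j ⟧ ⟦ τ i < τ j ⟧ ⟦ f j < f i ⟧

module _ {m : ℕ} where

  private
    τ₀₁ : Fin (suc (suc m)) → Fin (suc (suc m))
    τ₀₁ = transpose zero (suc zero)

  -- The only inversion of (0 1) is the pair (0, 1).
  invParity-transpose₀₁ : invParity τ₀₁ ≡ 1ℙ
  invParity-transpose₀₁ = cong₂ _⊕_ first-row (cong₂ _⊕_ second-row later-rows)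
    where
    row : Fin (suc (suc m)) → Parity
    row i = ∑[ j < suc (suc m) ] (⟦ i < j ⟧ ⊗ ⟦ τ₀₁ j < τ₀₁ i ⟧)
    first-row : row zero ≡ 1ℙ
    first-row = cong _⁻¹ (∑-zero (λ j → ⟦ zero < suc (suc j) ⟧ ⊗ ⟦ τ₀₁ (suc (suc j)) < τ₀₁ zero ⟧) λ _ → refl)
    second-row : row (suc zero) ≡ 0ℙ
    second-row = ∑-zero (λ j → ⟦ suc zero < j ⟧ ⊗ ⟦ τ₀₁ j < τ₀₁ (suc zero) ⟧) λ j → ℙP.*-zeroʳ ⟦ suc zero < j ⟧
    later-rows : ∑[ i < m ] row (suc (suc i)) ≡ 0ℙ
    later-rows = ∑-zero (λ i → row (suc (suc i))) λ i →
      ∑-zero (λ j → ⟦ suc (suc i) < j ⟧ ⊗ ⟦ τ₀₁ j < τ₀₁ (suc (suc i)) ⟧) λ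
        { zero → refl
        ; (suc zero) → refl
        ; (suc (suc j)) → ⟦<⟧-asym (suc (suc i)) (suc (suc j)) }

  -- (0 q) is conjugate to (0 1) by (1 q), hence has the same inversion parity.
  invParity-transpose₀ : (q : Fin (suc (suc m))) → q ≢ zero → invParity (transpose zero q) ≡ 1ℙ
  invParity-transpose₀ zero q≢0 = ⊥-elim (q≢0 refl)
  invParity-transpose₀ (suc zero) _ = invParity-transpose₀₁
  invParity-transpose₀ (suc (suc q)) _ = begin
    invParity (transpose zero q′)
      ≡⟨ invParity-cong (transpose-conjugate zero (suc zero) q′ (λ ()) (λ ()) (λ ())) ⟩
    invParity (τ₁q ∘ τ₀₁ ∘ τ₁q)
      ≡⟨ invParity-∘transpose (τ₁q ∘ τ₀₁) τ₁q∘τ₀₁-injective (suc zero) q′ ⟩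
    invParity (τ₁q ∘ τ₀₁) ⊕ invParity τ₁q
      ≡⟨ cong (_⊕ invParity τ₁q) (invParity-∘transpose τ₁q (transpose-injective (suc zero) q′) zero (suc zero)) ⟩
    invParity τ₁q ⊕ invParity τ₀₁ ⊕ invParity τ₁q
      ≡⟨ cancel (invParity τ₁q) (invParity τ₀₁) ⟩
    invParity τ₀₁
      ≡⟨ invParity-transpose₀₁ ⟩
    1ℙ
      ∎
    where
    open ≡-Reasoning
    q′ : Fin (suc (suc m))
    q′ = suc (suc q)
    τ₁q : Fin (suc (suc m)) → Fin (suc (suc m))
    τ₁q = transpose (suc zero) q′
    τ₁q∘τ₀₁-injective : ∀ x y → τ₁q (τ₀₁ x) ≡ τ₁q (τ₀₁ y) → x ≡ y
    τ₁q∘τ₀₁-injective x y = transpose-injective zero (suc zero) x y ∘ transpose-injective (suc zero) q′ _ _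
    cancel : ∀ p r → p ⊕ r ⊕ p ≡ r
    cancel 0ℙ 0ℙ = refl
    cancel 0ℙ 1ℙ = refl
    cancel 1ℙ 0ℙ = refl
    cancel 1ℙ 1ℙ = refl

sign : {n : ℕ} → Seq n → Parity
sign v = parity (inversions v)

bit : Parity → ℕ
bit 0ℙ = 0
bit 1ℙ = 1

%2-parity : ∀ m → m % 2 ≡ bit (parity m)
%2-parity 0 = refl
%2-parity 1 = refl
%2-parity (suc (suc m)) = %2-parity m

sign-even : {n : ℕ} (v : Seq n) → sign v ≡ 0ℙ → IsEven v
sign-even v even = trans (%2-parity (inversions v)) (cong bit even)

sign-odd : {n : ℕ} (v : Seq n) → sign v ≡ 1ℙ → ¬ IsEven v
sign-odd v odd isEven = ℕP.1+n≢0 (trans (sym (trans (%2-parity (inversions v)) (cong bit odd))) isEven)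

module _ {n : ℕ} where

  -- Parity is additive, so it commutes with the sums in the definition of inversions.
  parity-sum : (h : Fin n → ℕ) → parity (ListAction.sum (map h (allFin n))) ≡ ∑[ i < n ] parity (h i)
  parity-sum h = trans (cong (parity ∘ ListAction.sum) (ListP.map-tabulate (λ i → i) h)) (tabulated n h)
    where
    tabulated : ∀ k (g : Fin k → ℕ) → parity (ListAction.sum (tabulate g)) ≡ ∑[ i < k ] parity (g i)
    tabulated zero g = refl
    tabulated (suc k) g =
      trans (ℙP.+-homo-+ (g zero) (ListAction.sum (tabulate (g ∘ suc))))
            (cong (parity (g zero) ⊕_) (tabulated k (g ∘ suc)))

  sign≡invParity : (v : Seq n) → sign v ≡ invParity (lookup v)
  sign≡invParity v =
    trans (parity-sum _) (sum-cong-≗ λ i → trans (parity-sum _) (sum-cong-≗ λ j →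
      indicator (does (i <ᶠ? j)) (does (lookup v j <ᶠ? lookup v i))))
    where
    indicator : ∀ a b → parity (if a ∧ b then 1 else 0) ≡ fromBool a ⊗ fromBool b
    indicator false b = refl
    indicator true false = refl
    indicator true true = refl

  -- Exchanging two entries of a permutation composes it with a transposition.
  sign-swap : (v : Seq n) (a b : Fin n) → IsPerm v → sign (swap v a b) ≡ sign v ⊕ invParity (transpose a b)
  sign-swap v a b v-perm = begin
    sign (swap v a b)                                ≡⟨ sign≡invParity (swap v a b) ⟩
    invParity (lookup (swap v a b))                  ≡⟨ invParity-cong (lookup-swap v a b) ⟩
    invParity (lookup v ∘ transpose a b)             ≡⟨ invParity-∘transpose (lookup v) v-perm a b ⟩
    invParity (lookup v) ⊕ invParity (transpose a b) ≡⟨ cong (_⊕ invParity (transpose a b)) (sign≡invParity v) ⟨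
    sign v ⊕ invParity (transpose a b)               ∎
    where open ≡-Reasoning

sign-swap₀ : {m : ℕ} (v : Seq (suc (suc m))) (q : Fin (suc (suc m))) → IsPerm v → q ≢ zero →
  sign (swap v zero q) ≡ sign v ⁻¹
sign-swap₀ v q v-perm q≢0 =
  trans (sign-swap v zero q v-perm)
        (trans (cong (sign v ⊕_) (invParity-transpose₀ q q≢0)) (ℙP.+-comm (sign v) 1ℙ))

_++ʷ_ : {A : Set} {R : A → A → Set} {x y z : A} {a b : ℕ} →
  Walk R x y a → Walk R y z b → Walk R x z (a + b)
nil ++ʷ w = w
cons r u ++ʷ w = cons r (u ++ʷ w)

star-arc : {n : ℕ} {v w : Seq (suc n)} → StarAdj v w → Σ (Fin (suc n)) λ i → 1 ≤ toℕ i × w ≡ swap v zero i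
star-arc {v = v} (z , i , z≡0 , 1≤i , w≡) =
  i , 1≤i , trans w≡ (cong (λ z′ → swap v z′ i) (FinP.toℕ-injective {i = z} {j = zero} z≡0))

nonzero : {n : ℕ} {i : Fin (suc n)} → 1 ≤ toℕ i → i ≢ zero
nonzero () refl

≡-or-⁻¹ : (p q : Parity) → p ≡ q ⊎ p ≡ q ⁻¹
≡-or-⁻¹ 0ℙ 0ℙ = inj₁ refl
≡-or-⁻¹ 0ℙ 1ℙ = inj₂ refl
≡-or-⁻¹ 1ℙ 0ℙ = inj₂ refl
≡-or-⁻¹ 1ℙ 1ℙ = inj₁ refl

-- Bookkeeping for the length bound L ≤ 4d + 1: a segment of c arcs simulating
-- e star arcs keeps the bound whenever c ≤ 4e.
extend-bound : {c L : ℕ} (e d : ℕ) → c ≤ 4 * e → L ≤ 4 * d + 1 → c + L ≤ 4 * (e + d) + 1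
extend-bound {c} {L} e d c≤ L≤ = begin
  c + L               ≤⟨ ℕP.+-mono-≤ c≤ L≤ ⟩
  4 * e + (4 * d + 1) ≡⟨ ℕP.+-assoc (4 * e) (4 * d) 1 ⟨
  4 * e + 4 * d + 1   ≡⟨ cong (_+ 1) (ℕP.*-distribˡ-+ 4 e d) ⟨
  4 * (e + d) + 1     ∎
  where open ℕP.≤-Reasoning

module Oriented (m : ℕ) where

  N : ℕ
  N = suc (suc (suc m))

  K : ℕ
  K = kOf N

  OrientedWalk : Seq N → Seq N → ℕ → Set
  OrientedWalk = Walk (OrientedArc {N})

  -- The sign a permutation must have to use position q: positions 2..k are used
  -- by even permutations, positions k+1..n by odd ones.
  side : Fin N → Parity
  side q = fromBool (does (K ℕ.≤? toℕ q))

  arc : (v : Seq N) (q : Fin N) → 1 ≤ toℕ q → side q ≡ sign v → OrientedArc v (swap v zero q)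
  arc v q 1≤q side≡sign with K ℕ.≤? toℕ q
  ... | yes K≤q = zero , q , refl , refl , inj₂ (sign-odd v (trans (sym side≡sign) (cong fromBool (dec-true (K ℕ.≤? toℕ q) K≤q))) , K≤q)
  ... | no K≰q = zero , q , refl , refl ,
        inj₁ (sign-even v (trans (sym side≡sign) (cong fromBool (dec-false (K ℕ.≤? toℕ q) K≰q))) , 1≤q ,
               subst (_≤ K) (ℕP.+-comm 1 (toℕ q)) (ℕP.≰⇒> K≰q))

  -- Both sides contain a position (here n ≥ 3 is used).
  position-on-side : (p : Parity) → Σ (Fin N) λ b → 1 ≤ toℕ b × side b ≡ p
  position-on-side 0ℙ = suc zero , s≤s z≤n , cong fromBool (dec-false (K ℕ.≤? 1) K≰1)
    where
    K≰1 : ¬ K ≤ 1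
    K≰1 (s≤s K∸1≤0) with ℕP.≤-trans (ℕP.m≤n+m 1 _) K∸1≤0
    ... | ()
  position-on-side 1ℙ = last , subst (1 ≤_) (sym (FinP.toℕ-fromℕ _)) (s≤s z≤n) ,
                         cong fromBool (dec-true (K ℕ.≤? toℕ last) (subst (K ≤_) (sym (FinP.toℕ-fromℕ _)) K≤n-1))
    where
    last : Fin N
    last = fromℕ (suc (suc m))
    K≤n-1 : K ≤ suc (suc m)
    K≤n-1 = s≤s (subst (_≤ suc m) (ℕP.+-comm 1 _) (s≤s (ℕP.⌈n/2⌉≤n m)))

  zigzag : ℕ → Seq N → Fin N → Fin N → Seq N
  zigzag zero v x y = v
  zigzag (suc ℓ) v x y = zigzag ℓ (swap v zero x) y x

  -- If x lies on the side of the current sign and y on the other, every step of the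
  -- zigzag is an arc, because every exchange flips the sign.
  zigzag-walk : (ℓ : ℕ) (v : Seq N) (x y : Fin N) → IsPerm v → 1 ≤ toℕ x → 1 ≤ toℕ y →
    side x ≡ sign v → side y ≡ sign v ⁻¹ → OrientedWalk v (zigzag ℓ v x y) ℓ
  zigzag-walk zero v x y _ _ _ _ _ = nil
  zigzag-walk (suc ℓ) v x y v-perm 1≤x 1≤y x-side y-side =
    cons (arc v x 1≤x x-side)
         (zigzag-walk ℓ (swap v zero x) y x (swap-preserves-perm v zero x v-perm) 1≤y 1≤x
            (trans y-side (sym flipped))
            (trans x-side (sym (trans (cong _⁻¹ flipped) (ℙP.⁻¹-involutive (sign v))))))
    where
    flipped : sign (swap v zero x) ≡ sign v ⁻¹
    flipped = sign-swap₀ v x v-perm (nonzero 1≤x)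

  detour₅ : (v : Seq N) (i : Fin N) → IsPerm v → 1 ≤ toℕ i → side i ≡ sign v ⁻¹ →
    OrientedWalk v (swap v zero i) 5
  detour₅ v i v-perm 1≤i i-side with position-on-side (sign v)
  ... | b , 1≤b , b-side =
    subst (λ w → OrientedWalk v w 5) (swap⁵ v zero b i (nonzero 1≤b) (nonzero 1≤i) b≢i)
          (zigzag-walk 5 v b i v-perm 1≤b 1≤i b-side i-side)
    where
    b≢i : b ≢ i
    b≢i refl = ℙP.p≢p⁻¹ (sign v) (trans (sym b-side) i-side)

  detour₄ : (v : Seq N) (i j : Fin N) → IsPerm v → 1 ≤ toℕ i → 1 ≤ toℕ j →
    side i ≡ sign v ⁻¹ → side j ≡ sign v → OrientedWalk v (swap (swap v zero i) zero j) 4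
  detour₄ v i j v-perm 1≤i 1≤j i-side j-side =
    subst (λ w → OrientedWalk v w 4) (swap⁴ v zero i j (nonzero 1≤i) (nonzero 1≤j) i≢j)
          (zigzag-walk 4 v j i v-perm 1≤j 1≤i j-side i-side)
    where
    i≢j : i ≢ j
    i≢j refl = ℙP.p≢p⁻¹ (sign v) (trans (sym j-side) i-side)

  -- Simulation of a star-graph walk of length d by an oriented walk of length at
  -- most 4d + 1.  An allowed exchange is one arc; a blocked exchange followed by an
  -- allowed one takes four arcs; two blocked exchanges take a five-arc detour and
  -- then one arc (the detour flips the sign, so the second becomes allowed); a
  -- final blocked exchange takes the five-arc detour.
  simulate : {v t : Seq N} {d : ℕ} → IsPerm v → Walk StarAdj v t d →
    Σ ℕ λ L → OrientedWalk v t L × L ≤ 4 * d + 1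
  simulate v-perm nil = 0 , nil , z≤n
  simulate {v} v-perm (cons {ℓ = d} a w) with star-arc a
  ... | i , 1≤i , refl with ≡-or-⁻¹ (side i) (sign v)
  ...   | inj₁ i-allowed with simulate (swap-preserves-perm v zero i v-perm) w
  ...     | L , u , L≤ = suc L , cons (arc v i 1≤i i-allowed) u , extend-bound 1 d (s≤s z≤n) L≤
  simulate {v} v-perm (cons {ℓ = d} a w) | i , 1≤i , refl | inj₂ i-blocked with w
  ...     | nil = 5 , detour₅ v i v-perm 1≤i i-blocked , ℕP.≤-refl
  ...     | cons {ℓ = d′} a′ w′ with star-arc a′
  ...       | j , 1≤j , refl
    with simulate (swap-preserves-perm (swap v zero i) zero j (swap-preserves-perm v zero i v-perm)) w′
       | ≡-or-⁻¹ (side j) (sign v)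
  ...         | L , u , L≤ | inj₁ j-allowed =
    4 + L , detour₄ v i j v-perm 1≤i 1≤j i-blocked j-allowed ++ʷ u , extend-bound 2 d′ (ℕP.m≤m+n 4 4) L≤
  ...         | L , u , L≤ | inj₂ j-blocked =
    6 + L ,
    detour₅ v i v-perm 1≤i i-blocked ++ʷ cons (arc (swap v zero i) j 1≤j now-allowed) u ,
    extend-bound 2 d′ (ℕP.m≤m+n 6 2) L≤
    where
    now-allowed : side j ≡ sign (swap v zero i)
    now-allowed = trans j-blocked (sym (sign-swap₀ v i v-perm (nonzero 1≤i)))

module _ (P : ℕ → Set) (P? : ∀ k → Dec (P k)) where

  Least : ℕ → Set
  Least d = P d × (∀ k → k < d → ¬ P k)

  least-or-none : ∀ L → (Σ ℕ λ d → Least d × d ≤ L) ⊎ (∀ k → k ≤ L → ¬ P k)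
  least-or-none zero with P? zero
  ... | yes p = inj₁ (zero , (p , λ _ ()) , z≤n)
  ... | no ¬p = inj₂ λ { zero z≤n → ¬p }
  least-or-none (suc L) with least-or-none L
  ... | inj₁ (d , least , d≤L) = inj₁ (d , least , ℕP.m≤n⇒m≤1+n d≤L)
  ... | inj₂ none with P? (suc L)
  ...   | yes p = inj₁ (suc L , (p , λ k k<1+L → none k (ℕP.≤-pred k<1+L)) , ℕP.≤-refl)
  ...   | no ¬p = inj₂ λ k k≤1+L → [ (λ k<1+L → none k (ℕP.≤-pred k<1+L)) , (λ { refl → ¬p }) ]′
                                     (ℕP.m≤n⇒m<n∨m≡n k≤1+L)

  least : ∀ L → P L → Σ ℕ λ d → Least d × d ≤ L
  least L p with least-or-none L
  ... | inj₁ found = found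
  ... | inj₂ none = ⊥-elim (none L ℕP.≤-refl p)

module _ {n : ℕ} where

  oriented-arc? : (s : Seq n) (z j : Fin n) →
    Dec (toℕ z ≡ 0 × ((IsEven s × 1 ≤ toℕ j × toℕ j + 1 ≤ kOf n) ⊎ (¬ IsEven s × kOf n ≤ toℕ j)))
  oriented-arc? s z j =
    (toℕ z ℕP.≟ 0) ×-dec ((even? ×-dec ((1 ℕ.≤? toℕ j) ×-dec (toℕ j + 1 ℕ.≤? kOf n)))
                          ⊎-dec (¬? even? ×-dec (kOf n ℕ.≤? toℕ j)))
    where
    even? : Dec (IsEven s)
    even? = inversions s % 2 ℕP.≟ 0

  oriented-walk? : (k : ℕ) (s t : Seq n) → Dec (Walk OrientedArc s t k)
  oriented-walk? zero s t with VecP.≡-dec FinP._≟_ s t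
  ... | yes refl = yes nil
  ... | no s≢t = no λ { nil → s≢t refl }
  oriented-walk? (suc k) s t
    with FinP.any? (λ z → FinP.any? (λ j → oriented-arc? s z j ×-dec oriented-walk? k (swap s z j) t))
  ... | yes (z , j , (z≡0 , allowed) , w) = yes (cons (z , j , z≡0 , refl , allowed) w)
  ... | no none = no λ { (cons (z , j , z≡0 , refl , allowed) w) → none (z , j , (z≡0 , allowed) , w) }

corollary1 : (n : ℕ) → 3 ≤ n → (s t : Seq n) → IsPerm s → IsPerm t →
    (d : ℕ) → IsDistance StarAdj s t d →
    Σ ℕ (λ d⃗ → IsDistance OrientedArc s t d⃗ × d⃗ ≤ 4 * d + 4)
corollary1 (suc (suc (suc m))) _ s t s-perm _ d (star-walk , _)
  with Oriented.simulate m s-perm star-walk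
... | L , oriented-walk , L≤4d+1
  with least (λ k → Walk OrientedArc s t k) (λ k → oriented-walk? k s t) L oriented-walk
... | d⃗ , distance , d⃗≤L =
  d⃗ , distance , ℕP.≤-trans d⃗≤L (ℕP.≤-trans L≤4d+1 (ℕP.+-monoʳ-≤ (4 * d) (s≤s z≤n)))
corollary1 (suc zero) (s≤s ())
corollary1 (suc (suc zero)) (s≤s (s≤s ()))
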